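{- Let $m$ be a positive integer, let $B\subseteq m\mathbb Z$ be a finite nonempty set, and let $F\subseteq\mathbb Z$ be a finite nonempty set all of whose elements are congruent modulo $m$ to a single $\tilde f\in\{1,\dots,m-1\}$. If \[m\ge \tilde f+2\tilde f\left\lfloor\frac{|B|+1}{\tilde f}\right\rfloor+\operatorname{mod}_{\tilde f}(|B|+1),\] then $C=m\mathbb N\cup B\cup F$ arises as a minimal additive complement in $\mathbb Z$.
   Context: $\mathbb N=\{0,1,2,\dots\}$; $\operatorname{mod}_k n$ denotes the remainder of $n$ upon division by $k$. For subsets $C,W$ of $\mathbb Z$, $C+W=\{c+w:c\in C,w\in W\}$. $C$ is a minimal additive complement (MAC) to $W$ if $C+W=\mathbb Z$ and no proper subset $C'\subsetneq C$ satisfies $C'+W=\mathbb Z$. $C$ arises as a MAC if there exists some $W\subseteq\mathbb Z$ to which $C$ is a MAC. -}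

module Defs where

open import Level using (0ℓ)
open import Data.Nat using (ℕ) renaming (_*_ to _*ℕ_)
open import Data.Integer using (ℤ; +_; _+_)
open import Data.Product using (Σ; ∃; _×_)
open import Data.Sum using (_⊎_)
open import Data.List using (List)
open import Data.List.Membership.Propositional using (_∈_)
open import Relation.Nullary using (¬_)
open import Relation.Binary.PropositionalEquality using (_≡_)

Subset : Set₁
Subset = ℤ → Set

_⊆_ : Subset → Subset → Set
C ⊆ D = ∀ z → C z → D z

Covers : Subset → Subset → Set
Covers C W = ∀ z → Σ ℤ λ c → Σ ℤ λ w → C c × W w × c + w ≡ z

IsMAC : Subset → Subset → Set₁
IsMAC C W = Covers C W ×
  (¬ Σ Subset λ C' → (C' ⊆ C) × (¬ (C ⊆ C')) × Covers C' W)

ArisesAsMAC : Subset → Set₁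
ArisesAsMAC C = Σ Subset λ W → IsMAC C W

mℕ : ℕ → Subset
mℕ m z = Σ ℕ λ n → z ≡ + (m *ℕ n)

⟦_⟧ : List ℤ → Subset
⟦ xs ⟧ z = z ∈ xs

_∪_ : Subset → Subset → Subset
(C ∪ D) z = C z ⊎ D z

-- The complement W is built residue class by residue class. The anchors
-- s i = i + f ⌊i / f⌋, i ≤ |B|, are distinct modulo m and no s i + f is congruent to an
-- anchor, so a sum c + w in the class of s i comes either from c ∈ mℕ ∪ B ⊆ m ℤ with
-- w = s i, or from c ∈ F ⊆ f + m ℤ with w in the class of s i - f; the latter w belong to W
-- only when they pass a guard. Every element of C is then the only possible summand for one
-- point: n ∈ mℕ for n + s 0, b_k ∈ B for b_k + s (k + 1), and y ∈ F for its target, a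
-- multiple of m far below F ∪ B; the guards exclude all competing representations.
-- Covering a negative z ≡ 0 needs some x ∈ F such that z - x does not carry another element
-- of F onto a target; since targets are far apart, if every x failed, a translate of F would
-- fit inside F minus a point.

module Submission where

open import Defs
open import Data.Nat as ℕ using (ℕ)
import Data.Nat.Properties as ℕ
open import Data.Integer using (ℤ; +_; _-_)
open import Data.Integer.Divisibility using (_∣_)
open import Data.List using (List; _∷_; length)
open import Data.List.Relation.Unary.All using (All)

module Spread where

  open import Data.Nat
  open import Data.Nat.Properties
  open import Data.Nat.DivMod
  open import Data.Nat.Tactic.RingSolver using (solve-∀)
  open import Data.Empty using (⊥-elim)
  open import Relation.Binary.Definitions using (tri<; tri≈; tri>)
  open import Relation.Binary.PropositionalEquality
  open import Relation.Nullary using (yes; no)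

  module _ (f : ℕ) .{{_ : NonZero f}} where

    spread : ℕ → ℕ
    spread i = i + f * (i / f)

    spread-zero : spread 0 ≡ 0
    spread-zero = trans (cong (f *_) (0/n≡0 f)) (*-zeroʳ f)

    spread-mono-< : ∀ {i j} → i < j → spread i < spread j
    spread-mono-< i<j = +-mono-<-≤ i<j (*-monoʳ-≤ f (/-monoˡ-≤ f (<⇒≤ i<j)))

    spread-injective : ∀ {i j} → spread i ≡ spread j → i ≡ j
    spread-injective {i} {j} eq with <-cmp i j
    ... | tri< i<j _ _ = ⊥-elim (<-irrefl eq (spread-mono-< i<j))
    ... | tri≈ _ i≡j _ = i≡j
    ... | tri> _ _ j<i = ⊥-elim (<-irrefl (sym eq) (spread-mono-< j<i))

    spread-blocks : ∀ i → spread i ≡ i % f + 2 * (f * (i / f))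
    spread-blocks i = begin
      i + f * (i / f)                 ≡⟨ cong (_+ f * (i / f)) (m≡m%n+[m/n]*n i f) ⟩
      i % f + i / f * f + f * (i / f) ≡⟨ regroup (i % f) (i / f) f ⟩
      i % f + 2 * (f * (i / f))       ∎
      where
      open ≡-Reasoning
      regroup : ∀ r q f → r + q * f + f * q ≡ r + 2 * (f * q)
      regroup = solve-∀

    -- The values of spread fill the blocks [2fq, 2fq + f), which are separated by
    -- gaps of length f; a shift by f therefore always lands in a gap.
    spread+f≢spread : ∀ i j → spread i + f ≢ spread j
    spread+f≢spread i j eq with j / f ≤? i / f
    ... | yes j/f≤i/f = <-irrefl (sym eq) (begin-strict
      spread j                        ≡⟨ spread-blocks j ⟩
      j % f + 2 * (f * (j / f))       ≤⟨ +-monoʳ-≤ (j % f) (*-monoʳ-≤ 2 (*-monoʳ-≤ f j/f≤i/f)) ⟩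
      j % f + 2 * (f * (i / f))       <⟨ +-monoˡ-< (2 * (f * (i / f))) (m%n<n j f) ⟩
      f + 2 * (f * (i / f))           ≤⟨ m≤n+m _ (i % f) ⟩
      i % f + (f + 2 * (f * (i / f))) ≡⟨ regroup (i % f) f (2 * (f * (i / f))) ⟩
      i % f + 2 * (f * (i / f)) + f   ≡⟨ cong (_+ f) (spread-blocks i) ⟨
      spread i + f                    ∎)
      where
      open ≤-Reasoning
      regroup : ∀ r f t → r + (f + t) ≡ r + t + f
      regroup = solve-∀
    ... | no j/f≰i/f = <-irrefl eq (begin-strict
      spread i + f                    ≡⟨ cong (_+ f) (spread-blocks i) ⟩
      i % f + 2 * (f * (i / f)) + f   <⟨ +-monoˡ-< f (+-monoˡ-< (2 * (f * (i / f))) (m%n<n i f)) ⟩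
      f + 2 * (f * (i / f)) + f       ≡⟨ regroup f (i / f) ⟩
      2 * (f * suc (i / f))           ≤⟨ *-monoʳ-≤ 2 (*-monoʳ-≤ f (≰⇒> j/f≰i/f)) ⟩
      2 * (f * (j / f))               ≤⟨ m≤n+m _ (j % f) ⟩
      j % f + 2 * (f * (j / f))       ≡⟨ spread-blocks j ⟨
      spread j                        ∎)
      where
      open ≤-Reasoning
      regroup : ∀ f q → f + 2 * (f * q) + f ≡ 2 * (f * suc q)
      regroup = solve-∀

    SpreadFits : ℕ → ℕ → Set
    SpreadFits n m = f + 2 * f * (n / f) + n % f ≤ m

    spread+f< : ∀ {i n m} → i < n → SpreadFits n m → spread i + f < m
    spread+f< {i} {n} {m} i<n bound = begin-strict
      spread i + f                        <⟨ +-monoˡ-< f (spread-mono-< i<n) ⟩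
      n + f * (n / f) + f                 ≡⟨ cong (λ t → t + f * (n / f) + f) (m≡m%n+[m/n]*n n f) ⟩
      n % f + n / f * f + f * (n / f) + f ≡⟨ regroup (n % f) (n / f) f ⟩
      f + 2 * f * (n / f) + n % f         ≤⟨ bound ⟩
      m                                   ∎
      where
      open ≤-Reasoning
      regroup : ∀ r q f → r + q * f + f * q + f ≡ f + 2 * f * q + r
      regroup = solve-∀

module IntegerArithmetic where

  import Data.Nat.Divisibility as ℕ
  open import Data.Integer
  open import Data.Integer.Properties
  open import Data.Integer.Divisibility.Signed as Signed using (∣⇒∣ᵤ; ∣m⇒∣-m; ∣m∣n⇒∣m+n; ∣m∣n⇒∣m-n)
  open import Data.Integer.Tactic.RingSolver using (solve-∀)
  open import Data.Empty using (⊥-elim)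
  open import Function using (_∘_)
  open import Relation.Binary.PropositionalEquality
  open import Relation.Nullary using (Dec)
  open import Relation.Nullary.Decidable using (map′)

  infix 4 _≡_mod_ _≡?_mod_

  -- A record rather than a synonym for k ∣ a - b, so that a and b can be inferred.
  record _≡_mod_ (a b k : ℤ) : Set where
    constructor ≡mod
    field
      ∣-difference : k Signed.∣ a - b

  _≡?_mod_ : ∀ a b k → Dec (a ≡ b mod k)
  a ≡? b mod k = map′ ≡mod _≡_mod_.∣-difference (k Signed.∣? (a - b))

  ∣⇒≡0-mod : ∀ {k a} → k Signed.∣ a → a ≡ 0ℤ mod k
  ∣⇒≡0-mod {k} {a} = ≡mod ∘ subst (k Signed.∣_) (sym (+-identityʳ a))

  ≡0-mod⇒∣ : ∀ {k a} → a ≡ 0ℤ mod k → k Signed.∣ a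
  ≡0-mod⇒∣ {k} {a} (≡mod k∣a-0) = subst (k Signed.∣_) (+-identityʳ a) k∣a-0

  module _ {k : ℤ} where

    ≡mod-sym : ∀ {a b} → a ≡ b mod k → b ≡ a mod k
    ≡mod-sym {a} {b} (≡mod k∣a-b) = ≡mod (subst (k Signed.∣_) (negate a b) (∣m⇒∣-m k∣a-b))
      where
      negate : ∀ a b → - (a - b) ≡ b - a
      negate = solve-∀

    ≡mod-trans : ∀ {a b c} → a ≡ b mod k → b ≡ c mod k → a ≡ c mod k
    ≡mod-trans {a} {b} {c} (≡mod k∣a-b) (≡mod k∣b-c) =
      ≡mod (subst (k Signed.∣_) (+-minus-telescope a b c) (∣m∣n⇒∣m+n k∣a-b k∣b-c))

    ≡mod-+ʳ : ∀ {a b} c → a ≡ b mod k → a + c ≡ b + c mod k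
    ≡mod-+ʳ {a} {b} c (≡mod k∣a-b) = ≡mod (subst (k Signed.∣_) (shift a b c) k∣a-b)
      where
      shift : ∀ a b c → a - b ≡ a + c - (b + c)
      shift = solve-∀

    ≡mod-cancelˡ : ∀ {c r w t} → c ≡ r mod k → c + w ≡ t mod k → w + r ≡ t mod k
    ≡mod-cancelˡ {c} {r} {w} {t} (≡mod k∣c-r) (≡mod k∣c+w-t) =
      ≡mod (subst (k Signed.∣_) (cancel c r w t) (∣m∣n⇒∣m-n k∣c+w-t k∣c-r))
      where
      cancel : ∀ c r w t → c + w - t - (c - r) ≡ w + r - t
      cancel = solve-∀

    ≡mod-cancel-0ˡ : ∀ {c w t} → c ≡ 0ℤ mod k → c + w ≡ t mod k → w ≡ t mod k
    ≡mod-cancel-0ˡ {w = w} {t} c≡0 c+w≡t = subst (_≡ t mod k) (+-identityʳ w) (≡mod-cancelˡ c≡0 c+w≡t)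

  ∣∧∣i∣<k⇒i≡0 : ∀ {k i} → + k ∣ i → ∣ i ∣ ℕ.< k → i ≡ 0ℤ
  ∣∧∣i∣<k⇒i≡0 {i = i} k∣i ∣i∣<k with ∣ i ∣ in ∣i∣≡
  ... | ℕ.zero  = ∣i∣≡0⇒i≡0 ∣i∣≡
  ... | ℕ.suc _ = ⊥-elim (ℕ.>⇒∤ ∣i∣<k k∣i)

  ≡mod-<⇒≡ : ∀ {a b m} → a ℕ.< m → b ℕ.< m → + a ≡ + b mod + m → a ≡ b
  ≡mod-<⇒≡ {a} {b} a<m b<m (≡mod m∣a-b) =
    +-injective (i-j≡0⇒i≡j (+ a) (+ b) (∣∧∣i∣<k⇒i≡0 (∣⇒∣ᵤ m∣a-b) ∣a-b∣<m))
    where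
    ∣a-b∣<m : ∣ + a - + b ∣ ℕ.< _
    ∣a-b∣<m = subst (ℕ._< _) (cong ∣_∣ (sym (m-n≡m⊖n a b)))
                (ℕ.≤-<-trans (∣m⊝n∣≤m⊔n a b) (ℕ.⊔-lub a<m b<m))

  ≤-by-slack : ∀ {i j} k → 0ℤ ≤ k → i + k ≡ j → i ≤ j
  ≤-by-slack {i} k 0≤k refl = subst (_≤ i + k) (+-identityʳ i) (+-monoʳ-≤ i 0≤k)

  <-by-slack : ∀ {i j} k → 0ℤ ≤ k → i + k + 1ℤ ≡ j → i < j
  <-by-slack {i} k 0≤k i+k+1≡j = suc[i]≤j⇒i<j (≤-by-slack k 0≤k (trans (reorder i k) i+k+1≡j))
    where
    reorder : ∀ i k → 1ℤ + i + k ≡ i + k + 1ℤ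
    reorder = solve-∀

  infixl 6 _+≥0_
  infixl 7 _*≥0_

  _+≥0_ : ∀ {i j} → 0ℤ ≤ i → 0ℤ ≤ j → 0ℤ ≤ i + j
  _+≥0_ = +-mono-≤

  _*≥0_ : ∀ {i j} → 0ℤ ≤ i → 0ℤ ≤ j → 0ℤ ≤ i * j
  +≤+ {n = a} _ *≥0 +≤+ {n = b} _ = subst (0ℤ ≤_) (pos-* a b) (+≤+ ℕ.z≤n)

  i≤+∣i∣ : ∀ i → i ≤ + ∣ i ∣
  i≤+∣i∣ (+ n)    = ≤-refl
  i≤+∣i∣ -[1+ n ] = -≤+

  -+∣i∣≤i : ∀ i → - + ∣ i ∣ ≤ i
  -+∣i∣≤i (+ n)    = neg-≤-pos
  -+∣i∣≤i -[1+ n ] = ≤-refl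

  i<i+j : ∀ i {j} → 0ℤ < j → i < i + j
  i<i+j i 0<j = subst (_< i + _) (+-identityʳ i) (+-monoʳ-< i 0<j)

  i+j<i : ∀ i {j} → j < 0ℤ → i + j < i
  i+j<i i j<0 = subst (i + _ <_) (+-identityʳ i) (+-monoʳ-< i j<0)

  i+[j-i]≡j : ∀ i j → i + (j - i) ≡ j
  i+[j-i]≡j = solve-∀

  +-cancelʳ-≡ : ∀ {i j} k → i + k ≡ j + k → i ≡ j
  +-cancelʳ-≡ {i} {j} k i+k≡j+k = i-j≡0⇒i≡j i j (trans (difference i j k) (i≡j⇒i-j≡0 i+k≡j+k))
    where
    difference : ∀ i j k → i - j ≡ i + k - (j + k)
    difference = solve-∀

module FiniteSets where

  open import Data.Integer
  open import Data.Integer.Properties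
  import Data.List as List
  open import Data.List.Membership.Propositional using (_∈_)
  open import Data.List.Relation.Unary.Any using (here; there)
  import Data.List.Relation.Unary.All as All
  import Data.List.Relation.Unary.All.Properties as All
  import Data.List.Extrema ≤-totalOrder as Extrema
  import Data.List.Extrema ℕ.≤-totalOrder as ℕExtrema
  open import Data.Product using (_×_; proj₁; proj₂)
  open import Data.Sum using ([_,_]′)
  open import Relation.Binary.Definitions using (tri<; tri≈; tri>)
  open import Relation.Binary.PropositionalEquality
  open import Relation.Nullary using (¬_)
  open IntegerArithmetic using (i≤+∣i∣; -+∣i∣≤i; i<i+j; i+j<i)

  maxAbs : List ℤ → ℕ
  maxAbs xs = ℕExtrema.max 0 (List.map ∣_∣ xs)

  module _ {x : ℤ} {xs : List ℤ} (x∈xs : x ∈ xs) where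

    ∣∣≤maxAbs : ∣ x ∣ ℕ.≤ maxAbs xs
    ∣∣≤maxAbs = All.lookup (All.map⁻ (ℕExtrema.xs≤max 0 (List.map ∣_∣ xs))) x∈xs

    -maxAbs≤ : - + maxAbs xs ≤ x
    -maxAbs≤ = ≤-trans (neg-mono-≤ (+≤+ ∣∣≤maxAbs)) (-+∣i∣≤i x)

    ≤maxAbs : x ≤ + maxAbs xs
    ≤maxAbs = ≤-trans (i≤+∣i∣ x) (+≤+ ∣∣≤maxAbs)

  module _ (x₀ : ℤ) (xs : List ℤ) where

    max : ℤ
    max = Extrema.max x₀ xs

    min : ℤ
    min = Extrema.min x₀ xs

    max∈ : max ∈ x₀ ∷ xs
    max∈ = [ (λ eq → subst (_∈ x₀ ∷ xs) (sym eq) (here refl)) , there ]′ (Extrema.argmax-sel (λ x → x) x₀ xs)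

    min∈ : min ∈ x₀ ∷ xs
    min∈ = [ (λ eq → subst (_∈ x₀ ∷ xs) (sym eq) (here refl)) , there ]′ (Extrema.argmin-sel (λ x → x) x₀ xs)

    ≤max : ∀ {y} → y ∈ x₀ ∷ xs → y ≤ max
    ≤max (here refl) = Extrema.⊥≤max x₀ xs
    ≤max (there y∈)  = All.lookup (Extrema.xs≤max x₀ xs) y∈

    min≤ : ∀ {y} → y ∈ x₀ ∷ xs → min ≤ y
    min≤ (here refl) = Extrema.min≤⊤ x₀ xs
    min≤ (there y∈)  = All.lookup (Extrema.min≤xs x₀ xs) y∈

    no-translate-into-punctured : ∀ {y} δ → y ∈ x₀ ∷ xs →
      ¬ (∀ {x} → x ∈ x₀ ∷ xs → x + δ ∈ x₀ ∷ xs × x + δ ≢ y)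
    no-translate-into-punctured {y} δ y∈ translate with <-cmp δ 0ℤ
    ... | tri< δ<0 _ _  = <⇒≱ (i+j<i min δ<0) (min≤ (proj₁ (translate min∈)))
    ... | tri≈ _ refl _ = proj₂ (translate y∈) (+-identityʳ y)
    ... | tri> _ _ δ>0  = <⇒≱ (i<i+j max δ>0) (≤max (proj₁ (translate max∈)))

module Construction
  (m f : ℕ) .{{_ : ℕ.NonZero m}} .{{_ : ℕ.NonZero f}}
  (B : List ℤ) (B⊆mℤ : All (λ b → + m ∣ b) B)
  (x₀ : ℤ) (xs : List ℤ) (F⊆f+mℤ : All (λ x → + m ∣ x - + f) (x₀ ∷ xs))
  (fits : Spread.SpreadFits f (length B ℕ.+ 1) m)
  where

  open import Data.Fin using (Fin; zero; suc; toℕ)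
  open import Data.Fin.Properties using (toℕ-injective; toℕ<n; any?)
  open import Data.Integer hiding (suc)
  open import Data.Integer.Properties
  open import Data.Integer.Divisibility using (divides)
  open import Data.Integer.Divisibility.Signed as Signed using (∣ᵤ⇒∣; ∣⇒∣ᵤ; ∣-refl; ∣m⇒∣m*n)
  open import Data.Integer.Tactic.RingSolver using (solve-∀)
  open import Data.List using (lookup; _++_)
  open import Data.List.Membership.Propositional using (_∈_; find; lose)
  open import Data.List.Membership.Propositional.Properties using (∈-lookup; ∈-++⁺ˡ; ∈-++⁺ʳ)
  open import Data.List.Relation.Unary.Any as Any using (Any; here)
  open import Data.List.Relation.Unary.Any.Properties using (lookup-index)
  import Data.List.Relation.Unary.All as All
  open import Data.List.Relation.Unary.All.Properties using (¬Any⇒All¬)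
  open import Data.Empty using (⊥-elim)
  open import Function using (_∘_)
  open import Data.Product using (Σ; ∃; _×_; _,_; map₂)
  open import Data.Sum using (_⊎_; inj₁; inj₂)
  import Data.Sum as Sum
  open import Relation.Binary.Definitions using (tri<; tri≈; tri>)
  open import Relation.Binary.PropositionalEquality
  open import Relation.Nullary using (¬_; Dec; yes; no; ¬?)
  open import Relation.Nullary.Decidable using (_×-dec_; decidable-stable)
  open Spread
  open IntegerArithmetic
  open FiniteSets

  F : List ℤ
  F = x₀ ∷ xs

  C₀ C : Subset
  C₀ = mℕ m ∪ ⟦ B ⟧
  C = C₀ ∪ ⟦ F ⟧

  Index : Set
  Index = Fin (ℕ.suc (length B))

  anchor : Index → ℤ
  anchor i = + spread f (toℕ i)

  anchor-zero : anchor zero ≡ 0ℤ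
  anchor-zero = cong +_ (spread-zero f)

  spread+f<m : ∀ i → spread f (toℕ i) ℕ.+ f ℕ.< m
  spread+f<m i = spread+f< f (subst (toℕ i ℕ.<_) (ℕ.+-comm 1 (length B)) (toℕ<n i)) fits

  spread<m : ∀ i → spread f (toℕ i) ℕ.< m
  spread<m i = ℕ.≤-<-trans (ℕ.m≤m+n _ f) (spread+f<m i)

  anchor-injective : ∀ {i j} → anchor i ≡ anchor j mod + m → i ≡ j
  anchor-injective {i} {j} i≡j = toℕ-injective (spread-injective f (≡mod-<⇒≡ (spread<m i) (spread<m j) i≡j))

  anchor+f≢anchor : ∀ i j → ¬ (anchor i + + f ≡ anchor j mod + m)
  anchor+f≢anchor i j shifted = spread+f≢spread f (toℕ i) (toℕ j)
    (≡mod-<⇒≡ (spread+f<m i) (spread<m j) (subst (_≡ anchor j mod + m) (sym (pos-+ _ f)) shifted))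

  ∣⇒≡anchor-zero : ∀ {z} → + m Signed.∣ z → z ≡ anchor zero mod + m
  ∣⇒≡anchor-zero {z} = subst (λ a → z ≡ a mod + m) (sym anchor-zero) ∘ ∣⇒≡0-mod

  ≡anchor-zero⇒∣ : ∀ {z} → z ≡ anchor zero mod + m → + m Signed.∣ z
  ≡anchor-zero⇒∣ {z} = ≡0-mod⇒∣ ∘ subst (λ a → z ≡ a mod + m) anchor-zero

  m∣multiple : ∀ n → + m Signed.∣ + (m ℕ.* n)
  m∣multiple n = subst (+ m Signed.∣_) (sym (pos-* m n)) (∣m⇒∣m*n (+ n) ∣-refl)

  C₀≡0 : ∀ {c} → C₀ c → c ≡ 0ℤ mod + m
  C₀≡0 (inj₁ (n , refl)) = ∣⇒≡0-mod (m∣multiple n)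
  C₀≡0 (inj₂ b∈B)        = ∣⇒≡0-mod (∣ᵤ⇒∣ (All.lookup B⊆mℤ b∈B))

  C₀+t≡t : ∀ {c} → C₀ c → ∀ t → c + t ≡ t mod + m
  C₀+t≡t {c} c∈C₀ t = subst (λ a → c + t ≡ a mod + m) (+-identityˡ t) (≡mod-+ʳ t (C₀≡0 c∈C₀))

  F≡f : ∀ {x} → x ∈ F → x ≡ + f mod + m
  F≡f x∈F = ≡mod (∣ᵤ⇒∣ (All.lookup F⊆f+mℤ x∈F))

  nonNeg-multiple∈mℕ : ∀ {z} → 0ℤ ≤ z → + m Signed.∣ z → mℕ m z
  nonNeg-multiple∈mℕ {z} 0≤z m∣z with ∣⇒∣ᵤ m∣z
  ... | divides q ∣z∣≡q*m = q , trans (sym (0≤i⇒+∣i∣≡i 0≤z)) (cong +_ (trans ∣z∣≡q*m (ℕ.*-comm q m)))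

  mℕ⇒nonNeg : ∀ {z} → mℕ m z → 0ℤ ≤ z
  mℕ⇒nonNeg (_ , refl) = +≤+ ℕ.z≤n

  D : ℤ
  D = + maxAbs (F ++ B)

  x+D≥0 : ∀ {x} → x ∈ F → 0ℤ ≤ x + D
  x+D≥0 {x} x∈F = subst (λ t → 0ℤ ≤ x + t) (neg-involutive D) (i≤j⇒0≤j-i (-maxAbs≤ (∈-++⁺ˡ x∈F)))

  D-x≥0 : ∀ {x} → x ∈ F → 0ℤ ≤ D - x
  D-x≥0 x∈F = i≤j⇒0≤j-i (≤maxAbs (∈-++⁺ˡ x∈F))

  -D≤B : ∀ {b} → b ∈ B → - D ≤ b
  -D≤B b∈B = -maxAbs≤ (∈-++⁺ʳ F b∈B)

  D≥0 : 0ℤ ≤ D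
  D≥0 = +≤+ ℕ.z≤n

  m-1≥0 : 0ℤ ≤ + m - 1ℤ
  m-1≥0 = i≤j⇒0≤j-i (+≤+ (ℕ.>-nonZero⁻¹ m))

  S : ℤ
  S = D + D + D + D + 1ℤ

  S≥0 : 0ℤ ≤ S
  S≥0 = D≥0 +≥0 D≥0 +≥0 D≥0 +≥0 D≥0 +≥0 +≤+ ℕ.z≤n

  mS≥0 : 0ℤ ≤ + m * S
  mS≥0 = +≤+ {n = m} ℕ.z≤n *≥0 S≥0

  -- S exceeds every |a - b + c - d| with a, b, c, d ∈ F ∪ B, so distinct targets are
  -- further apart than that; all targets lie below -4D, and R bounds target y - x from below.
  target : ℤ → ℤ
  target y = - (+ m * S * (y + D + 1ℤ))

  R : ℤ
  R = + m * S * (D + D + 1ℤ) + D + D + 1ℤ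

  record Hit (w : ℤ) : Set where
    field
      centre witness : ℤ
      centre∈F : centre ∈ F
      witness∈F : witness ∈ F
      distinct : witness ≢ centre
      reaches : w + witness ≡ target centre

  Hits : ℤ → Set
  Hits w = Any (λ y → Any (λ y′ → y′ ≢ y × w + y′ ≡ target y) F) F

  hits? : ∀ w → Dec (Hits w)
  hits? w = Any.any? (λ y → Any.any? (λ y′ → ¬? (y′ ≟ y) ×-dec (w + y′ ≟ target y)) F) F

  hit : ∀ {w} → Hits w → Hit w
  hit h =
    let y  , y∈F  , h′ = find h
        y′ , y′∈F , y′≢y , reaches = find h′
    in record { centre = y ; witness = y′ ; centre∈F = y∈F ; witness∈F = y′∈F ; distinct = y′≢y ; reaches = reaches }

  open Hit

  target≡0 : ∀ y → target y ≡ anchor zero mod + m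
  target≡0 y = ∣⇒≡anchor-zero (Signed.divides (- (S * (y + D + 1ℤ))) (factor (+ m) S (y + D + 1ℤ)))
    where
    factor : ∀ m s t → - (m * s * t) ≡ - (s * t) * m
    factor = solve-∀

  target<-D : ∀ {y} → y ∈ F → target y < - D
  target<-D {y} y∈F = <-by-slack (+ m * S * (y + D) + (+ m - 1ℤ) * S + (D + D + D))
    (mS≥0 *≥0 x+D≥0 y∈F +≥0 m-1≥0 *≥0 S≥0 +≥0 (D≥0 +≥0 D≥0 +≥0 D≥0))
    (identity (+ m) D y)
    where
    identity : ∀ m D y → let S = D + D + D + D + 1ℤ in
      - (m * S * (y + D + 1ℤ)) + (m * S * (y + D) + (m - 1ℤ) * S + (D + D + D)) + 1ℤ ≡ - D
    identity = solve-∀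

  target-gap : ∀ {u v a b c d} → u < v → a ∈ F → b ∈ F → c ∈ F → d ∈ F →
               target v + a - b < target u + c - d
  target-gap {u} {v} {a} {b} {c} {d} u<v a∈F b∈F c∈F d∈F =
    <-by-slack (+ m * S * (v - (1ℤ + u)) + (+ m - 1ℤ) * S + (c + D) + (D - d) + (D - a) + (b + D))
      (mS≥0 *≥0 i≤j⇒0≤j-i (i<j⇒suc[i]≤j u<v) +≥0 m-1≥0 *≥0 S≥0
        +≥0 x+D≥0 c∈F +≥0 D-x≥0 d∈F +≥0 D-x≥0 a∈F +≥0 x+D≥0 b∈F)
      (identity (+ m) D u v a b c d)
    where
    identity : ∀ m D u v a b c d → let S = D + D + D + D + 1ℤ in
      - (m * S * (v + D + 1ℤ)) + a - b
        + (m * S * (v - (1ℤ + u)) + (m - 1ℤ) * S + (c + D) + (D - d) + (D - a) + (b + D)) + 1ℤ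
      ≡ - (m * S * (u + D + 1ℤ)) + c - d
    identity = solve-∀

  hit-far-below : ∀ z {x a c} → (h : Hit (z - x)) → x ∈ F → a ∈ F → c ∈ F → a + (z - c) < 0ℤ
  hit-far-below z {x} {a} {c} h x∈F a∈F c∈F =
    <-by-slack (+ m * S * (y + D) + (+ m - 1ℤ) * S + (y′ + D) + (D - a) + (D - x) + (c + D))
      (mS≥0 *≥0 x+D≥0 (centre∈F h) +≥0 m-1≥0 *≥0 S≥0 +≥0 x+D≥0 (witness∈F h)
        +≥0 D-x≥0 a∈F +≥0 D-x≥0 x∈F +≥0 x+D≥0 c∈F)
      (trans (identity (+ m) D z x a c y y′) (i≡j⇒i-j≡0 (reaches h)))
    where
    y y′ : ℤ
    y = centre h
    y′ = witness h
    identity : ∀ m D z x a c y y′ → let S = D + D + D + D + 1ℤ in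
      a + (z - c) + (m * S * (y + D) + (m - 1ℤ) * S + (y′ + D) + (D - a) + (D - x) + (c + D)) + 1ℤ
      ≡ z - x + y′ - - (m * S * (y + D + 1ℤ))
    identity = solve-∀

  hit>-R : ∀ {w} → Hit w → - R < w
  hit>-R {w} h = <-by-slack (+ m * S * (D - y) + (D - y′) + D)
    (mS≥0 *≥0 D-x≥0 (centre∈F h) +≥0 D-x≥0 (witness∈F h) +≥0 D≥0)
    (trans (identity (+ m) D w y y′) (trans (cong (λ t → w - t) (i≡j⇒i-j≡0 (reaches h))) (+-identityʳ w)))
    where
    y y′ : ℤ
    y = centre h
    y′ = witness h
    identity : ∀ m D w y y′ → let S = D + D + D + D + 1ℤ in
      - (m * S * (D + D + 1ℤ) + D + D + 1ℤ) + (m * S * (D - y) + (D - y′) + D) + 1ℤ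
      ≡ w - (w + y′ - - (m * S * (y + D + 1ℤ)))
    identity = solve-∀

  ≤-R⇒<-D : ∀ {w x} → w ≤ - R → x ∈ F → x + w < - D
  ≤-R⇒<-D {w} {x} w≤-R x∈F = <-by-slack (- R - w + (D - x) + + m * S * (D + D + 1ℤ))
    (i≤j⇒0≤j-i w≤-R +≥0 D-x≥0 x∈F +≥0 mS≥0 *≥0 (D≥0 +≥0 D≥0 +≥0 +≤+ ℕ.z≤n))
    (identity (+ m) D w x)
    where
    identity : ∀ m D w x → let S = D + D + D + D + 1ℤ ; R = m * S * (D + D + 1ℤ) + D + D + 1ℤ in
      x + w + (- R - w + (D - x) + m * S * (D + D + 1ℤ)) + 1ℤ ≡ - D
    identity = solve-∀

  multiple-below : ∀ z → z - + (m ℕ.* ∣ z + R ∣) ≤ - R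
  multiple-below z = ≤-by-slack (+ (m ℕ.* n) - + n + (+ n - (z + R)))
    (i≤j⇒0≤j-i (+≤+ (ℕ.m≤n*m n m)) +≥0 i≤j⇒0≤j-i (i≤+∣i∣ (z + R)))
    (identity z (+ (m ℕ.* n)) (+ n) R)
    where
    n : ℕ
    n = ∣ z + R ∣
    identity : ∀ z P N R → z - P + (P - N + (N - (z + R))) ≡ - R
    identity = solve-∀

  -- Guard i w rules out exactly the representations that would make an element of C
  -- redundant: in class 0 those of nonnegative multiples of m and of the targets of F,
  -- in class k + 1 that of b_k + anchor (k + 1).
  Guard : Index → ℤ → Set
  Guard zero    w = (∀ {x} → x ∈ F → x + w < 0ℤ) × ¬ Hits w
  Guard (suc k) w = ∀ {x} → x ∈ F → x + w ≢ lookup B k + anchor (suc k)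

  Free : ℤ → Set
  Free w = ¬ (∃ λ i → w ≡ anchor i mod + m) × ¬ (∃ λ i → w + + f ≡ anchor i mod + m)

  W : Subset
  W w = (∃ λ i → w ≡ anchor i) ⊎ (∃ λ i → w + + f ≡ anchor i mod + m × Guard i w) ⊎ Free w

  sum-residue : ∀ {c w t} → C c → c + w ≡ t mod + m →
                (C₀ c × w ≡ t mod + m) ⊎ (c ∈ F × w + + f ≡ t mod + m)
  sum-residue (inj₁ c∈C₀) c+w≡t = inj₁ (c∈C₀ , ≡mod-cancel-0ˡ (C₀≡0 c∈C₀) c+w≡t)
  sum-residue (inj₂ c∈F) c+w≡t = inj₂ (c∈F , ≡mod-cancelˡ (F≡f c∈F) c+w≡t)

  W-unshifted : ∀ {w i} → W w → w ≡ anchor i mod + m → w ≡ anchor i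
  W-unshifted (inj₁ (j , refl)) w≡i = cong anchor (anchor-injective w≡i)
  W-unshifted {i = i} (inj₂ (inj₁ (j , w+f≡j , _))) w≡i =
    ⊥-elim (anchor+f≢anchor i j (≡mod-trans (≡mod-+ʳ (+ f) (≡mod-sym w≡i)) w+f≡j))
  W-unshifted (inj₂ (inj₂ (unshifted , _))) w≡i = ⊥-elim (unshifted (_ , w≡i))

  W-shifted : ∀ {w i} → W w → w + + f ≡ anchor i mod + m → Guard i w
  W-shifted {i = i} (inj₁ (j , refl)) w+f≡i = ⊥-elim (anchor+f≢anchor j i w+f≡i)
  W-shifted {w} (inj₂ (inj₁ (j , w+f≡j , guard))) w+f≡i =
    subst (λ k → Guard k w) (anchor-injective (≡mod-trans (≡mod-sym w+f≡j) w+f≡i)) guard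
  W-shifted (inj₂ (inj₂ (_ , shifted))) w+f≡i = ⊥-elim (shifted (_ , w+f≡i))

  classify : ∀ {c w i} → C c → W w → c + w ≡ anchor i mod + m →
             (C₀ c × w ≡ anchor i) ⊎ (c ∈ F × Guard i w)
  classify c∈C w∈W = Sum.map (map₂ (W-unshifted w∈W)) (map₂ (W-shifted w∈W)) ∘ sum-residue c∈C

  hit-position : ∀ z x (h : Hit (z - x)) → z ≡ target (centre h) + x - witness h
  hit-position z x h = trans (isolate z x (witness h)) (cong (λ t → t + x - witness h) (reaches h))
    where
    isolate : ∀ z x y′ → z ≡ z - x + y′ + x - y′
    isolate = solve-∀

  hits-share-centre : ∀ z {x₁ x₂} (h₁ : Hit (z - x₁)) (h₂ : Hit (z - x₂)) → x₁ ∈ F → x₂ ∈ F →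
                      centre h₁ ≡ centre h₂
  hits-share-centre z {x₁} {x₂} h₁ h₂ x₁∈F x₂∈F with <-cmp (centre h₁) (centre h₂)
  ... | tri< u₁<u₂ _ _ = ⊥-elim (<-irrefl (trans (sym (hit-position z x₂ h₂)) (hit-position z x₁ h₁))
                           (target-gap u₁<u₂ x₂∈F (witness∈F h₂) x₁∈F (witness∈F h₁)))
  ... | tri≈ _ u₁≡u₂ _ = u₁≡u₂
  ... | tri> _ _ u₂<u₁ = ⊥-elim (<-irrefl (trans (sym (hit-position z x₁ h₁)) (hit-position z x₂ h₂))
                           (target-gap u₂<u₁ x₁∈F (witness∈F h₁) x₂∈F (witness∈F h₂)))

  -- If z - x were hit for every x ∈ F, all hits would share one centre y, and the
  -- witnesses would form the translate F + (target y - z) inside F ∖ {y}.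
  hits-not-everywhere : ∀ z → ¬ (∀ {x} → x ∈ F → Hits (z - x))
  hits-not-everywhere z hits = no-translate-into-punctured x₀ xs (target y - z) (centre∈F h₀) translate
    where
    h₀ : Hit (z - x₀)
    h₀ = hit (hits (here refl))
    y : ℤ
    y = centre h₀
    translate : ∀ {x} → x ∈ F → x + (target y - z) ∈ F × x + (target y - z) ≢ y
    translate {x} x∈F = subst (_∈ F) witness≡ (witness∈F h) , λ x+δ≡y → distinct h (trans witness≡ (trans x+δ≡y same))
      where
      h : Hit (z - x)
      h = hit (hits x∈F)
      same : y ≡ centre h
      same = hits-share-centre z h₀ h (here refl) x∈F
      witness≡ : witness h ≡ x + (target y - z)
      witness≡ = trans (isolate z x (witness h)) (cong (λ t → x + (t - z)) (trans (reaches h) (cong target (sym same))))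
        where
        isolate : ∀ z x y′ → y′ ≡ x + (z - x + y′ - z)
        isolate = solve-∀

  shift-below : ∀ {x z} → x ∈ F → x + (z - max x₀ xs) ≤ z
  shift-below {x} {z} x∈F = ≤-trans (+-monoˡ-≤ (z - max x₀ xs) (≤max x₀ xs x∈F)) (≤-reflexive (i+[j-i]≡j (max x₀ xs) z))

  shift-above : ∀ {x z} → x ∈ F → z ≤ x + (z - min x₀ xs)
  shift-above {x} {z} x∈F = ≤-trans (≤-reflexive (sym (i+[j-i]≡j (min x₀ xs) z))) (+-monoˡ-≤ (z - min x₀ xs) (min≤ x₀ xs x∈F))

  escape : ∀ {z} → z < 0ℤ → Σ ℤ λ x → x ∈ F × Guard zero (z - x)
  escape {z} z<0 = escape-from (hits? (z - max x₀ xs))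
    where
    escape-from-hit : Hits (z - max x₀ xs) → Dec (Any (λ x → ¬ Hits (z - x)) F) → Σ ℤ λ x → x ∈ F × Guard zero (z - x)
    escape-from-hit hits (yes escapes) =
      let x , x∈F , ¬hits = find escapes
      in x , x∈F , (λ a∈F → hit-far-below z (hit hits) (max∈ x₀ xs) a∈F x∈F) , ¬hits
    escape-from-hit _ (no ¬escapes) = ⊥-elim (hits-not-everywhere z λ {x} x∈F →
      decidable-stable (hits? (z - x)) (All.lookup (¬Any⇒All¬ F ¬escapes) x∈F))
    escape-from : Dec (Hits (z - max x₀ xs)) → Σ ℤ λ x → x ∈ F × Guard zero (z - x)
    escape-from (no ¬hits) = max x₀ xs , max∈ x₀ xs , (λ x∈F → ≤-<-trans (shift-below x∈F) z<0) , ¬hits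
    escape-from (yes hits) = escape-from-hit hits (Any.any? (λ x → ¬? (hits? (z - x))) F)

  Covered : ℤ → Set
  Covered z = Σ ℤ λ c → Σ ℤ λ w → C c × W w × c + w ≡ z

  cover-from-F : ∀ {z x i} → x ∈ F → z ≡ anchor i mod + m → Guard i (z - x) → Covered z
  cover-from-F {z} {x} {i} x∈F z≡i guard =
    x , z - x , inj₂ x∈F , inj₂ (inj₁ (i , shifted , guard)) , i+[j-i]≡j x z
    where
    shifted : z - x + + f ≡ anchor i mod + m
    shifted = ≡mod-cancelˡ (F≡f x∈F) (subst (_≡ anchor i mod + m) (sym (i+[j-i]≡j x z)) z≡i)

  cover-anchor-zero : ∀ {z} → z ≡ anchor zero mod + m → Covered z
  cover-anchor-zero {z} z≡0 with 0ℤ ≤? z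
  ... | yes 0≤z = z , anchor zero , inj₁ (inj₁ (nonNeg-multiple∈mℕ 0≤z (≡anchor-zero⇒∣ z≡0))) ,
                  inj₁ (zero , refl) , trans (cong (λ a → z + a) anchor-zero) (+-identityʳ z)
  ... | no 0≰z = let x , x∈F , guard = escape (≰⇒> 0≰z) in cover-from-F x∈F z≡0 guard

  cover-anchor-suc : ∀ {z} k → z ≡ anchor (suc k) mod + m → Covered z
  cover-anchor-suc {z} k z≡k+1 with <-cmp z (lookup B k + anchor (suc k))
  ... | tri< z<b+a _ _ = cover-from-F (max∈ x₀ xs) z≡k+1 λ x∈F → <⇒≢ (≤-<-trans (shift-below x∈F) z<b+a)
  ... | tri≈ _ refl _  = lookup B k , anchor (suc k) , inj₁ (inj₂ (∈-lookup k)) , inj₁ (suc k , refl) , refl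
  ... | tri> _ _ z>b+a = cover-from-F (min∈ x₀ xs) z≡k+1 λ x∈F → ≢-sym (<⇒≢ (<-≤-trans z>b+a (shift-above x∈F)))

  cover-shifted : ∀ {z} i → z + + f ≡ anchor i mod + m → Covered z
  cover-shifted {z} i z+f≡i = c , z - c , inj₁ (inj₁ (n , refl)) , inj₂ (inj₁ (i , shifted , guard i)) , i+[j-i]≡j c z
    where
    n : ℕ
    n = ∣ z + R ∣
    c : ℤ
    c = + (m ℕ.* n)
    w≤-R : z - c ≤ - R
    w≤-R = multiple-below z
    shifted : z - c + + f ≡ anchor i mod + m
    shifted = ≡mod-cancel-0ˡ (C₀≡0 (inj₁ (n , refl))) (subst (_≡ anchor i mod + m) (rearrange c z (+ f)) z+f≡i)
      where
      rearrange : ∀ c z f → z + f ≡ c + (z - c + f)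
      rearrange = solve-∀
    guard : ∀ i → Guard i (z - c)
    guard zero    = (λ x∈F → <-≤-trans (≤-R⇒<-D w≤-R x∈F) neg-≤-pos) , λ hits → <⇒≱ (hit>-R (hit hits)) w≤-R
    guard (suc k) = λ x∈F → <⇒≢ (<-≤-trans (≤-R⇒<-D w≤-R x∈F)
                      (≤-trans (-D≤B (∈-lookup k)) (i≤i+j (lookup B k) (anchor (suc k)))))

  cover : Covers C W
  cover z with any? (λ i → z ≡? anchor i mod + m)
  ... | yes (zero , z≡0)    = cover-anchor-zero z≡0
  ... | yes (suc k , z≡k+1) = cover-anchor-suc k z≡k+1
  ... | no unshifted with any? (λ i → z + + f ≡? anchor i mod + m)
  ...   | yes (i , z+f≡i) = cover-shifted i z+f≡i
  ...   | no shifted      = 0ℤ , z , inj₁ (inj₁ (0 , cong +_ (sym (ℕ.*-zeroʳ m)))) ,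
                            inj₂ (inj₂ (unshifted , shifted)) , +-identityˡ z

  target∉C₀ : ∀ {x} → x ∈ F → ¬ C₀ (target x)
  target∉C₀ x∈F (inj₁ t∈mℕ) = <⇒≱ (<-≤-trans (target<-D x∈F) neg-≤-pos) (mℕ⇒nonNeg t∈mℕ)
  target∉C₀ x∈F (inj₂ t∈B)  = <⇒≱ (target<-D x∈F) (-D≤B t∈B)

  +anchor-zero : ∀ {c z} → c + anchor zero ≡ z → c ≡ z
  +anchor-zero {c} c+a≡z = trans (sym (+-identityʳ c)) (trans (cong (λ a → c + a) (sym anchor-zero)) c+a≡z)

  module _ {C′ : Subset} (C′⊆C : C′ ⊆ C) (cover′ : Covers C′ W) where

    Representation : Index → ℤ → Set
    Representation i z = Σ ℤ λ c → C′ c × Σ ℤ λ w → c + w ≡ z × ((C₀ c × w ≡ anchor i) ⊎ (c ∈ F × Guard i w))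

    represent : ∀ {z} i → z ≡ anchor i mod + m → Representation i z
    represent {z} i z≡i =
      let c , w , c∈C′ , w∈W , c+w≡z = cover′ z
      in c , c∈C′ , w , c+w≡z , classify (C′⊆C c c∈C′) w∈W (subst (_≡ anchor i mod + m) (sym c+w≡z) z≡i)

    multiple-needed : ∀ {c} → mℕ m c → C′ c
    multiple-needed (n , refl) = from (represent zero (∣⇒≡anchor-zero (m∣multiple n))) (+≤+ ℕ.z≤n)
      where
      from : ∀ {c} → Representation zero c → 0ℤ ≤ c → C′ c
      from (c′ , c′∈C′ , _ , c′+w≡c , inj₁ (_ , refl))      _   = subst C′ (+anchor-zero c′+w≡c) c′∈C′
      from (_  , _     , _ , c′+w≡c , inj₂ (c′∈F , below , _)) 0≤c =
        ⊥-elim (<⇒≱ (below c′∈F) (subst (0ℤ ≤_) (sym c′+w≡c) 0≤c))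

    B-needed : ∀ {b} → b ∈ B → C′ b
    B-needed {b} b∈B = from (represent (suc k) (C₀+t≡t (inj₂ b∈B) (anchor (suc k))))
      where
      k : Fin (length B)
      k = Any.index b∈B
      from : Representation (suc k) (b + anchor (suc k)) → C′ b
      from (c′ , c′∈C′ , _ , c′+w≡z , inj₁ (_ , refl))   = subst C′ (+-cancelʳ-≡ (anchor (suc k)) c′+w≡z) c′∈C′
      from (_  , _     , _ , c′+w≡z , inj₂ (c′∈F , guard)) =
        ⊥-elim (guard c′∈F (trans c′+w≡z (cong (_+ anchor (suc k)) (lookup-index b∈B))))

    F-needed : ∀ {x} → x ∈ F → C′ x
    F-needed {x} x∈F = from (represent zero (target≡0 x))
      where
      from : Representation zero (target x) → C′ x
      from (c , _    , _ , c+w≡t , inj₁ (c∈C₀ , refl))     = ⊥-elim (target∉C₀ x∈F (subst C₀ (+anchor-zero c+w≡t) c∈C₀))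
      from (c , c∈C′ , w , c+w≡t , inj₂ (c∈F , _ , ¬hits)) =
        subst C′ (decidable-stable (c ≟ x) λ c≢x → ¬hits (lose x∈F (lose c∈F (c≢x , trans (+-comm w c) c+w≡t)))) c∈C′

  minimal : ¬ Σ Subset λ C′ → C′ ⊆ C × ¬ (C ⊆ C′) × Covers C′ W
  minimal (C′ , C′⊆C , C⊈C′ , cover′) = C⊈C′ needed
    where
    needed : C ⊆ C′
    needed c (inj₁ (inj₁ c∈mℕ)) = multiple-needed C′⊆C cover′ c∈mℕ
    needed c (inj₁ (inj₂ c∈B))  = B-needed C′⊆C cover′ c∈B
    needed c (inj₂ c∈F)         = F-needed C′⊆C cover′ c∈F

  arises-as-MAC : ArisesAsMAC C
  arises-as-MAC = W , cover , minimal

open import Data.Nat using (_≤_; _<_; _+_; _*_; NonZero)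
open import Data.Nat.DivMod using (_/_; _%_)
open import Data.List using ([])
open import Data.List.Relation.Unary.Unique.Propositional using (Unique)
open import Data.Empty using (⊥-elim)
open import Relation.Binary.PropositionalEquality using (_≢_; refl)

proposition5 : (m : ℕ) → 1 ≤ m →
    (B : List ℤ) → Unique B → B ≢ [] → All (λ b → (+ m) ∣ b) B →
    (F : List ℤ) → F ≢ [] →
    (f : ℕ) → .{{_ : NonZero f}} → f < m → All (λ x → (+ m) ∣ (x - + f)) F →
    f + 2 * f * ((length B + 1) / f) + (length B + 1) % f ≤ m →
    ArisesAsMAC ((mℕ m ∪ ⟦ B ⟧) ∪ ⟦ F ⟧)
proposition5 _ _   _ _ _ _    []        F≢[] _ _ _      _    = ⊥-elim (F≢[] refl)
proposition5 m 1≤m B _ _ B⊆mℤ (x₀ ∷ xs) _    f _ F⊆f+mℤ fits =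
  Construction.arises-as-MAC m f {{ℕ.>-nonZero 1≤m}} B B⊆mℤ x₀ xs F⊆f+mℤ fits
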